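{- For every prime $q$ there exists a subgroup $H$ of $\operatorname{GL}_2(\mathbb{Z}/2\mathbb{Z})\times \operatorname{GL}_2(\mathbb{Z}/q\mathbb{Z})$ such that (1) $H\cong S_3$, and (2) $H\cap\big(\operatorname{GL}_2(\mathbb{Z}/2\mathbb{Z})\times 1\big)$ and $H\cap\big(1\times \operatorname{GL}_2(\mathbb{Z}/q\mathbb{Z})\big)$ are both trivial. -}

module Defs where

open import Data.Nat using (ℕ; NonZero)
import Data.Nat as ℕ
open import Data.Nat.DivMod using (_mod_)
open import Data.Fin using (Fin; toℕ)
open import Data.Fin.Permutation using (Permutation′; _⟨$⟩ʳ_; _∘ₚ_)
open import Data.Product using (Σ; ∃; _×_; _,_; proj₁; proj₂)
open import Relation.Binary.PropositionalEquality using (_≡_)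

ZMod : ℕ → Set
ZMod n = Fin n

module _ {n : ℕ} .{{_ : NonZero n}} where

  infixl 6 _+ₙ_ _-ₙ_
  infixl 7 _*ₙ_

  0ₙ : ZMod n
  0ₙ = 0 mod n

  1ₙ : ZMod n
  1ₙ = 1 mod n

  _+ₙ_ : ZMod n → ZMod n → ZMod n
  a +ₙ b = (toℕ a ℕ.+ toℕ b) mod n

  _*ₙ_ : ZMod n → ZMod n → ZMod n
  a *ₙ b = (toℕ a ℕ.* toℕ b) mod n

  _-ₙ_ : ZMod n → ZMod n → ZMod n
  a -ₙ b = (toℕ a ℕ.+ (n ℕ.∸ toℕ b)) mod n

-- 2×2 matrices over ℤ/nℤ:  ( a  b )
--                           ( c  d )

record Mat₂ (n : ℕ) : Set where
  constructor mat
  field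
    a b c d : ZMod n

open Mat₂ public

module _ {n : ℕ} .{{_ : NonZero n}} where

  I₂ : Mat₂ n
  I₂ = mat 1ₙ 0ₙ 0ₙ 1ₙ

  infixl 7 _⊗_
  _⊗_ : Mat₂ n → Mat₂ n → Mat₂ n
  M ⊗ N = mat (a M *ₙ a N +ₙ b M *ₙ c N) (a M *ₙ b N +ₙ b M *ₙ d N)
              (c M *ₙ a N +ₙ d M *ₙ c N) (c M *ₙ b N +ₙ d M *ₙ d N)

  det : Mat₂ n → ZMod n
  det M = a M *ₙ d M -ₙ b M *ₙ c M

  IsUnit : ZMod n → Set
  IsUnit x = ∃ λ y → x *ₙ y ≡ 1ₙ

  InGL₂ : Mat₂ n → Set
  InGL₂ M = IsUnit (det M)

module _ {m n : ℕ} .{{_ : NonZero m}} .{{_ : NonZero n}} where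

  Elt : Set
  Elt = Mat₂ m × Mat₂ n

  1ᴱ : Elt
  1ᴱ = I₂ , I₂

  infixl 7 _·ᴱ_
  _·ᴱ_ : Elt → Elt → Elt
  (x , y) ·ᴱ (x′ , y′) = x ⊗ x′ , y ⊗ y′

  record IsSubgroupOfGL₂×GL₂ (H : Elt → Set) : Set where
    field
      ⊆GL₂×GL₂ : ∀ g → H g → InGL₂ (proj₁ g) × InGL₂ (proj₂ g)
      one∈     : H 1ᴱ
      mul∈     : ∀ g h → H g → H h → H (g ·ᴱ h)
      inv∈     : ∀ g → H g → ∃ λ h → H h × (g ·ᴱ h ≡ 1ᴱ) × (h ·ᴱ g ≡ 1ᴱ)

  TrivialMeetLeft : (Elt → Set) → Set
  TrivialMeetLeft H = ∀ g → H g → proj₂ g ≡ I₂ → g ≡ 1ᴱ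

  TrivialMeetRight : (Elt → Set) → Set
  TrivialMeetRight H = ∀ g → H g → proj₁ g ≡ I₂ → g ≡ 1ᴱ

-- The symmetric group S₃ = permutations of Fin 3, with equality
-- pointwise and multiplication (σ ·ₛ τ)(i) = σ (τ i).

S₃ : Set
S₃ = Permutation′ 3

_≈ₛ_ : S₃ → S₃ → Set
σ ≈ₛ τ = ∀ i → σ ⟨$⟩ʳ i ≡ τ ⟨$⟩ʳ i

_·ₛ_ : S₃ → S₃ → S₃
σ ·ₛ τ = τ ∘ₚ σ

module _ {m n : ℕ} .{{_ : NonZero m}} .{{_ : NonZero n}} where

  record IsoToS₃ (H : Elt {m} {n} → Set) : Set where
    field
      φ          : Σ Elt H → S₃
      well-def   : ∀ x y → proj₁ x ≡ proj₁ y → φ x ≈ₛ φ y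
      hom        : ∀ g h (g∈ : H g) (h∈ : H h) (gh∈ : H (g ·ᴱ h)) →
                   φ (g ·ᴱ h , gh∈) ≈ₛ (φ (g , g∈) ·ₛ φ (h , h∈))
      injective  : ∀ x y → φ x ≈ₛ φ y → proj₁ x ≡ proj₁ y
      surjective : ∀ σ → ∃ λ x → φ x ≈ₛ σ

-- S₃ permutes the coordinates of the lattice {v ∈ ℤ³ ∣ v₀ + v₁ + v₂ = 0}; in the basis
-- e₀ − e₂, e₁ − e₂ this is a homomorphism ρ : S₃ → GL₂(ℤ) with entries in {0, ±1}.
-- Its reduction modulo any n ≥ 2 is still injective: if σ moves 2, then the row of ρ σ
-- indexed by σ 2 has an off-diagonal entry 0 − 1 ≢ 0 (mod n); if σ fixes 2, then ρ σ is
-- the permutation matrix of σ on {0, 1}. Hence σ ↦ (ρ σ mod 2, ρ σ mod q) is an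
-- isomorphism from S₃ onto a subgroup H, and since both projections are injective on H,
-- H meets each factor trivially.

{-# OPTIONS --safe #-}
module Submission where

open import Defs
open import Data.Nat as ℕ
  using (ℕ; NonZero; NonTrivial; _<_; nonTrivial⇒nonZero; nonTrivial⇒≢1)
open import Data.Nat.DivMod using (m<n⇒m%n≡m)
open import Data.Nat.Divisibility using (n∣m⇒m%n≡0; ∣1⇒≡1)
import Data.Nat.Properties as ℕ
open import Data.Nat.Primality using (Prime; prime⇒nonZero; prime⇒nonTrivial)
open import Data.Integer using (ℤ; +_; _+_; _-_; _*_; -_; _⊖_; ∣_∣; 0ℤ; 1ℤ; -1ℤ; _%ℕ_; _/ℕ_)
open import Data.Integer.Properties
  using (pos-+; pos-*; m-n≡m⊖n; ⊖-≥; ∣m⊝n∣≤m⊔n; ∣i∣≡0⇒i≡0; i-j≡0⇒i≡j; +-injective)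
open import Data.Integer.DivMod using (n%ℕd<d; a≡a%ℕn+[a/ℕn]*n)
open import Data.Integer.Divisibility.Signed
  using (_∣_; divides; ∣m∣n⇒∣m+n; ∣m∣n⇒∣m-n; ∣m⇒∣-m; ∣n⇒∣m*n; ∣m⇒∣m*n; ∣⇒∣ᵤ)
open import Data.Integer.Tactic.RingSolver using (solve-∀)
open import Data.Fin using (Fin; toℕ; fromℕ<; _≟_)
open import Data.Fin.Patterns using (0F; 1F; 2F)
open import Data.Fin.Properties using (toℕ<n; toℕ-fromℕ<; toℕ-injective)
open import Data.Fin.Permutation using (_⟨$⟩ʳ_; id; flip; inverseˡ; inverseʳ)
open import Data.Product using (Σ; ∃; _×_; _,_; proj₁)
open import Function using (_$_)
open import Function.Bundles using (Injection)
open import Function.Properties.Inverse using (↔⇒↣)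
open import Relation.Nullary using (¬_; yes; no; contradiction)
open import Relation.Binary.PropositionalEquality

module Congruence (n : ℕ) where

  -- A record rather than a definition, so that x and y can be inferred from a proof.
  infix 4 _≡ₙ_
  record _≡ₙ_ (x y : ℤ) : Set where
    constructor congruent
    field n∣x-y : + n ∣ x - y

  ≡ₙ-sym : ∀ {x y} → x ≡ₙ y → y ≡ₙ x
  ≡ₙ-sym {x} {y} (congruent p) = congruent $ subst (+ n ∣_) (identity x y) (∣m⇒∣-m p)
    where
    identity : ∀ x y → - (x - y) ≡ y - x
    identity = solve-∀

  ≡ₙ-trans : ∀ {x y z} → x ≡ₙ y → y ≡ₙ z → x ≡ₙ z
  ≡ₙ-trans {x} {y} {z} (congruent p) (congruent q) =
    congruent $ subst (+ n ∣_) (identity x y z) (∣m∣n⇒∣m+n p q)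
    where
    identity : ∀ x y z → (x - y) + (y - z) ≡ x - z
    identity = solve-∀

  +-cong-≡ₙ : ∀ {x y u v} → x ≡ₙ y → u ≡ₙ v → x + u ≡ₙ y + v
  +-cong-≡ₙ {x} {y} {u} {v} (congruent p) (congruent q) =
    congruent $ subst (+ n ∣_) (identity x y u v) (∣m∣n⇒∣m+n p q)
    where
    identity : ∀ x y u v → (x - y) + (u - v) ≡ (x + u) - (y + v)
    identity = solve-∀

  ‿-cong-≡ₙ : ∀ {x y u v} → x ≡ₙ y → u ≡ₙ v → x - u ≡ₙ y - v
  ‿-cong-≡ₙ {x} {y} {u} {v} (congruent p) (congruent q) =
    congruent $ subst (+ n ∣_) (identity x y u v) (∣m∣n⇒∣m-n p q)
    where
    identity : ∀ x y u v → (x - y) - (u - v) ≡ (x - u) - (y - v)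
    identity = solve-∀

  *-cong-≡ₙ : ∀ {x y u v} → x ≡ₙ y → u ≡ₙ v → x * u ≡ₙ y * v
  *-cong-≡ₙ {x} {y} {u} {v} (congruent p) (congruent q) =
    congruent $ subst (+ n ∣_) (identity x y u v) (∣m∣n⇒∣m+n (∣m⇒∣m*n u p) (∣n⇒∣m*n y q))
    where
    identity : ∀ x y u v → (x - y) * u + y * (u - v) ≡ x * u - y * v
    identity = solve-∀

  i≡ₙi+n : ∀ x → x ≡ₙ x + + n
  i≡ₙi+n x = congruent (divides -1ℤ (identity x (+ n)))
    where
    identity : ∀ x k → x - (x + k) ≡ -1ℤ * k
    identity = solve-∀

cong₄ : ∀ {A B C D E : Set} (f : A → B → C → D → E) {w w′ x x′ y y′ z z′} →
        w ≡ w′ → x ≡ x′ → y ≡ y′ → z ≡ z′ → f w x y z ≡ f w′ x′ y′ z′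
cong₄ f refl refl refl refl = refl

record Mat₂ℤ : Set where
  constructor matℤ
  field a b c d : ℤ

infixl 7 _⊗ℤ_
_⊗ℤ_ : Mat₂ℤ → Mat₂ℤ → Mat₂ℤ
matℤ a b c d ⊗ℤ matℤ a′ b′ c′ d′ =
  matℤ (a * a′ + b * c′) (a * b′ + b * d′) (c * a′ + d * c′) (c * b′ + d * d′)

detℤ : Mat₂ℤ → ℤ
detℤ (matℤ a b c d) = a * d - b * c

detℤ-⊗ : ∀ M N → detℤ (M ⊗ℤ N) ≡ detℤ M * detℤ N
detℤ-⊗ (matℤ a b c d) (matℤ a′ b′ c′ d′) = identity a b c d a′ b′ c′ d′
  where
  identity : ∀ a b c d a′ b′ c′ d′ →
    (a * a′ + b * c′) * (c * b′ + d * d′) - (a * b′ + b * d′) * (c * a′ + d * c′) ≡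
    (a * d - b * c) * (a′ * d′ - b′ * c′)
  identity = solve-∀

module Reduction (n : ℕ) .{{_ : NonZero n}} where

  open Congruence n
  open ≡-Reasoning

  reduce : ℤ → ZMod n
  reduce x = fromℕ< (n%ℕd<d x n)

  ≡ₙ-reduce : ∀ x → x ≡ₙ + toℕ (reduce x)
  ≡ₙ-reduce x = congruent $ divides (x /ℕ n) (begin
    x - + toℕ (reduce x)                        ≡⟨ cong (λ r → x - + r) (toℕ-fromℕ< _) ⟩
    x - + (x %ℕ n)                              ≡⟨ cong (_- + (x %ℕ n)) (a≡a%ℕn+[a/ℕn]*n x n) ⟩
    (+ (x %ℕ n) + (x /ℕ n) * + n) - + (x %ℕ n)  ≡⟨ identity (+ (x %ℕ n)) (x /ℕ n) (+ n) ⟩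
    (x /ℕ n) * + n                              ∎)
    where
    identity : ∀ r q k → (r + q * k) - r ≡ q * k
    identity = solve-∀

  ≡ₙ⇒≡ : ∀ (i j : ZMod n) → + toℕ i ≡ₙ + toℕ j → i ≡ j
  ≡ₙ⇒≡ i j (congruent n∣i-j) =
    toℕ-injective (+-injective (i-j≡0⇒i≡j _ _ (∣i∣≡0⇒i≡0 distance≡0)))
    where
    distance<n : ∣ + toℕ i - + toℕ j ∣ < n
    distance<n = ℕ.≤-<-trans (ℕ.≤-reflexive (cong ∣_∣ (m-n≡m⊖n (toℕ i) (toℕ j))))
                   (ℕ.≤-<-trans (∣m⊝n∣≤m⊔n (toℕ i) (toℕ j)) (ℕ.⊔-pres-<m (toℕ<n i) (toℕ<n j)))
    distance≡0 : ∣ + toℕ i - + toℕ j ∣ ≡ 0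
    distance≡0 = trans (sym (m<n⇒m%n≡m distance<n)) (n∣m⇒m%n≡0 _ n (∣⇒∣ᵤ n∣i-j))

  reduce-cong : ∀ {x y} → x ≡ₙ y → reduce x ≡ reduce y
  reduce-cong {x} {y} x≡y =
    ≡ₙ⇒≡ _ _ (≡ₙ-trans (≡ₙ-sym (≡ₙ-reduce x)) (≡ₙ-trans x≡y (≡ₙ-reduce y)))

  reduce-≡⇒≡ₙ : ∀ {x y} → reduce x ≡ reduce y → x ≡ₙ y
  reduce-≡⇒≡ₙ {x} {y} eq = ≡ₙ-trans (≡ₙ-reduce x)
    (subst (λ r → + toℕ r ≡ₙ y) (sym eq) (≡ₙ-sym (≡ₙ-reduce y)))

  reduce-homo-+ : ∀ x y → reduce (x + y) ≡ reduce x +ₙ reduce y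
  reduce-homo-+ x y = reduce-cong {y = + (i ℕ.+ j)}
    (subst (x + y ≡ₙ_) (sym (pos-+ i j)) (+-cong-≡ₙ (≡ₙ-reduce x) (≡ₙ-reduce y)))
    where
    i j : ℕ
    i = toℕ (reduce x)
    j = toℕ (reduce y)

  reduce-homo-* : ∀ x y → reduce (x * y) ≡ reduce x *ₙ reduce y
  reduce-homo-* x y = reduce-cong {y = + (i ℕ.* j)}
    (subst (x * y ≡ₙ_) (sym (pos-* i j)) (*-cong-≡ₙ (≡ₙ-reduce x) (≡ₙ-reduce y)))
    where
    i j : ℕ
    i = toℕ (reduce x)
    j = toℕ (reduce y)

  reduce-homo‿- : ∀ x y → reduce (x - y) ≡ reduce x -ₙ reduce y
  reduce-homo‿- x y = reduce-cong {y = + (i ℕ.+ (n ℕ.∸ j))}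
    (≡ₙ-trans (‿-cong-≡ₙ (≡ₙ-reduce x) (≡ₙ-reduce y))
      (subst (+ i - + j ≡ₙ_) (sym +[i+[n∸j]]≡+i-+j++n) (i≡ₙi+n (+ i - + j))))
    where
    i j : ℕ
    i = toℕ (reduce x)
    j = toℕ (reduce y)
    +[i+[n∸j]]≡+i-+j++n : + (i ℕ.+ (n ℕ.∸ j)) ≡ + i - + j + + n
    +[i+[n∸j]]≡+i-+j++n = begin
      + (i ℕ.+ (n ℕ.∸ j))   ≡⟨ pos-+ i (n ℕ.∸ j) ⟩
      + i + + (n ℕ.∸ j)     ≡⟨ cong (_+_ (+ i)) (⊖-≥ (ℕ.<⇒≤ (toℕ<n (reduce y)))) ⟨
      + i + (n ⊖ j)         ≡⟨ cong (_+_ (+ i)) (m-n≡m⊖n n j) ⟨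
      + i + (+ n - + j)     ≡⟨ identity (+ i) (+ j) (+ n) ⟩
      + i - + j + + n       ∎
      where
      identity : ∀ a b k → a + (k - b) ≡ a - b + k
      identity = solve-∀

  reduce-unit : ∀ {x y} → x * y ≡ 1ℤ → IsUnit (reduce x)
  reduce-unit {x} {y} xy≡1 = reduce y , (begin
    reduce x *ₙ reduce y  ≡⟨ reduce-homo-* x y ⟨
    reduce (x * y)        ≡⟨ cong reduce xy≡1 ⟩
    reduce 1ℤ             ∎)

  reduceMat : Mat₂ℤ → Mat₂ n
  reduceMat (matℤ a b c d) = mat (reduce a) (reduce b) (reduce c) (reduce d)

  reduceMat-homo-⊗ : ∀ M N → reduceMat (M ⊗ℤ N) ≡ reduceMat M ⊗ reduceMat N
  reduceMat-homo-⊗ (matℤ a b c d) (matℤ a′ b′ c′ d′) =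
    cong₄ mat (entry a a′ b c′) (entry a b′ b d′) (entry c a′ d c′) (entry c b′ d d′)
    where
    entry : ∀ x y u v →
            reduce (x * y + u * v) ≡ reduce x *ₙ reduce y +ₙ reduce u *ₙ reduce v
    entry x y u v = trans (reduce-homo-+ (x * y) (u * v))
                          (cong₂ _+ₙ_ (reduce-homo-* x y) (reduce-homo-* u v))

  reduce-detℤ : ∀ M → reduce (detℤ M) ≡ det (reduceMat M)
  reduce-detℤ (matℤ a b c d) =
    trans (reduce-homo‿- (a * d) (b * c)) (cong₂ _-ₙ_ (reduce-homo-* a d) (reduce-homo-* b c))

  reduceMat-InGL₂ : ∀ M {y} → detℤ M * y ≡ 1ℤ → InGL₂ (reduceMat M)
  reduceMat-InGL₂ M {y} detM*y≡1 =
    subst IsUnit (reduce-detℤ M) (reduce-unit {detℤ M} {y} detM*y≡1)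

·ₛ-inverseʳ : ∀ σ → (σ ·ₛ flip σ) ≈ₛ id
·ₛ-inverseʳ σ _ = inverseʳ σ

·ₛ-inverseˡ : ∀ σ → (flip σ ·ₛ σ) ≈ₛ id
·ₛ-inverseˡ σ _ = inverseˡ σ

·ₛ-flip≈id⇒≈ : ∀ σ τ → (σ ·ₛ flip τ) ≈ₛ id → σ ≈ₛ τ
·ₛ-flip≈id⇒≈ σ τ h i = trans (cong (σ ⟨$⟩ʳ_) (sym (inverseˡ τ))) (h (τ ⟨$⟩ʳ i))

δ : Fin 3 → Fin 3 → ℤ
δ i j with i ≟ j
... | yes _ = 1ℤ
... | no  _ = 0ℤ

δ-expand : ∀ (f : Fin 3 → ℤ) x → f 0F * δ x 0F + f 1F * δ x 1F + f 2F * δ x 2F ≡ f x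
δ-expand f 0F = identity (f 0F) (f 1F) (f 2F)
  where
  identity : ∀ u v w → u * 1ℤ + v * 0ℤ + w * 0ℤ ≡ u
  identity = solve-∀
δ-expand f 1F = identity (f 0F) (f 1F) (f 2F)
  where
  identity : ∀ u v w → u * 0ℤ + v * 1ℤ + w * 0ℤ ≡ v
  identity = solve-∀
δ-expand f 2F = identity (f 0F) (f 1F) (f 2F)
  where
  identity : ∀ u v w → u * 0ℤ + v * 0ℤ + w * 1ℤ ≡ w
  identity = solve-∀

-- The r-th coordinate of e_x − e_y in the basis e₀ − e₂, e₁ − e₂.
coord : Fin 3 → Fin 3 → Fin 3 → ℤ
coord r x y = δ x r - δ y r

-- The linear form e_i ↦ f i, evaluated on e_x − e_y through its coordinates.
coord-expand : ∀ (f : Fin 3 → ℤ) x y →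
               (f 0F - f 2F) * coord 0F x y + (f 1F - f 2F) * coord 1F x y ≡ f x - f y
coord-expand f x y = begin
  (f 0F - f 2F) * coord 0F x y + (f 1F - f 2F) * coord 1F x y
    ≡⟨ split (f 0F) (f 1F) (f 2F) (δ x 0F) (δ x 1F) (δ x 2F) (δ y 0F) (δ y 1F) (δ y 2F) ⟩
  (g 0F * δ x 0F + g 1F * δ x 1F + g 2F * δ x 2F) -
  (g 0F * δ y 0F + g 1F * δ y 1F + g 2F * δ y 2F)
    ≡⟨ cong₂ _-_ (δ-expand g x) (δ-expand g y) ⟩
  (f x - f 2F) - (f y - f 2F)
    ≡⟨ cancel (f x) (f y) (f 2F) ⟩
  f x - f y
    ∎
  where
  open ≡-Reasoning
  g : Fin 3 → ℤ
  g j = f j - f 2F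
  split : ∀ u v w a b c a′ b′ c′ →
          (u - w) * (a - a′) + (v - w) * (b - b′) ≡
          ((u - w) * a + (v - w) * b + (w - w) * c) -
          ((u - w) * a′ + (v - w) * b′ + (w - w) * c′)
  split = solve-∀
  cancel : ∀ u v w → (u - w) - (v - w) ≡ u - v
  cancel = solve-∀

-- Column j of ρ σ holds the coordinates of σ (e_j − e₂) = e_{σ j} − e_{σ 2}.
ρ : S₃ → Mat₂ℤ
ρ σ = matℤ (coord 0F (σ ⟨$⟩ʳ 0F) (σ ⟨$⟩ʳ 2F)) (coord 0F (σ ⟨$⟩ʳ 1F) (σ ⟨$⟩ʳ 2F))
           (coord 1F (σ ⟨$⟩ʳ 0F) (σ ⟨$⟩ʳ 2F)) (coord 1F (σ ⟨$⟩ʳ 1F) (σ ⟨$⟩ʳ 2F))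

ρ-hom : ∀ σ τ → ρ σ ⊗ℤ ρ τ ≡ ρ (σ ·ₛ τ)
ρ-hom σ τ = cong₄ matℤ (entry 0F 0F) (entry 0F 1F) (entry 1F 0F) (entry 1F 1F)
  where
  entry : ∀ r i →
    coord r (σ ⟨$⟩ʳ 0F) (σ ⟨$⟩ʳ 2F) * coord 0F (τ ⟨$⟩ʳ i) (τ ⟨$⟩ʳ 2F) +
    coord r (σ ⟨$⟩ʳ 1F) (σ ⟨$⟩ʳ 2F) * coord 1F (τ ⟨$⟩ʳ i) (τ ⟨$⟩ʳ 2F) ≡
    coord r (σ ⟨$⟩ʳ (τ ⟨$⟩ʳ i)) (σ ⟨$⟩ʳ (τ ⟨$⟩ʳ 2F))
  entry r i = coord-expand (λ x → δ (σ ⟨$⟩ʳ x) r) (τ ⟨$⟩ʳ i) (τ ⟨$⟩ʳ 2F)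

ρ-cong : ∀ σ τ → σ ≈ₛ τ → ρ σ ≡ ρ τ
ρ-cong σ τ σ≈τ rewrite σ≈τ 0F | σ≈τ 1F | σ≈τ 2F = refl

ρ-det-unit : ∀ σ → detℤ (ρ σ) * detℤ (ρ (flip σ)) ≡ 1ℤ
ρ-det-unit σ = begin
  detℤ (ρ σ) * detℤ (ρ (flip σ))  ≡⟨ detℤ-⊗ (ρ σ) (ρ (flip σ)) ⟨
  detℤ (ρ σ ⊗ℤ ρ (flip σ))        ≡⟨ cong detℤ (ρ-hom σ (flip σ)) ⟩
  detℤ (ρ (σ ·ₛ flip σ))          ≡⟨ cong detℤ (ρ-cong (σ ·ₛ flip σ) id (·ₛ-inverseʳ σ)) ⟩
  detℤ (ρ id)                     ∎
  where open ≡-Reasoning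

module ReducedRepresentation (n : ℕ) .{{_ : NonZero n}} where

  open Reduction n

  ρ-mod : S₃ → Mat₂ n
  ρ-mod σ = reduceMat (ρ σ)

  ρ-mod-hom : ∀ σ τ → ρ-mod σ ⊗ ρ-mod τ ≡ ρ-mod (σ ·ₛ τ)
  ρ-mod-hom σ τ = trans (sym (reduceMat-homo-⊗ (ρ σ) (ρ τ))) (cong reduceMat (ρ-hom σ τ))

  ρ-mod-cong : ∀ σ τ → σ ≈ₛ τ → ρ-mod σ ≡ ρ-mod τ
  ρ-mod-cong σ τ σ≈τ = cong reduceMat (ρ-cong σ τ σ≈τ)

  ρ-mod-InGL₂ : ∀ σ → InGL₂ (ρ-mod σ)
  ρ-mod-InGL₂ σ = reduceMat-InGL₂ (ρ σ) (ρ-det-unit σ)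

last-of-three : ∀ {x : Fin 3} → x ≢ 0F → x ≢ 1F → x ≡ 2F
last-of-three {0F} x≢0 _ = contradiction refl x≢0
last-of-three {1F} _ x≢1 = contradiction refl x≢1
last-of-three {2F} _ _   = refl

module Faithfulness (n : ℕ) .{{_ : NonTrivial n}} where

  private instance
    n≢0 : NonZero n
    n≢0 = nonTrivial⇒nonZero n

  open Congruence n
  open Reduction n
  open ReducedRepresentation n

  1≢ₙ0 : ¬ (1ℤ ≡ₙ 0ℤ)
  1≢ₙ0 (congruent n∣1) = nonTrivial⇒≢1 (∣1⇒≡1 (∣⇒∣ᵤ n∣1))

  -1≢ₙ0 : ¬ (-1ℤ ≡ₙ 0ℤ)
  -1≢ₙ0 (congruent n∣-1) = 1≢ₙ0 (congruent (∣m⇒∣-m n∣-1))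

  reduce-coord≡1ₙ⇒≡ : ∀ {r x y} → y ≢ r → reduce (coord r x y) ≡ 1ₙ → x ≡ r
  reduce-coord≡1ₙ⇒≡ {r} {x} {y} y≢r eq with x ≟ r | y ≟ r
  ... | yes x≡r | _       = x≡r
  ... | no _    | yes y≡r = contradiction y≡r y≢r
  ... | no _    | no _    = contradiction (reduce-≡⇒≡ₙ (sym eq)) 1≢ₙ0

  reduce-coord≡0ₙ⇒≡ : ∀ {r x y} → y ≡ r → reduce (coord r x y) ≡ 0ₙ → x ≡ r
  reduce-coord≡0ₙ⇒≡ {r} {x} refl eq with x ≟ r | r ≟ r
  ... | yes x≡r | _      = x≡r
  ... | no _    | yes _  = contradiction (reduce-≡⇒≡ₙ eq) -1≢ₙ0
  ... | no _    | no r≢r = contradiction refl r≢r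

  ρ-mod-kernel : ∀ σ → ρ-mod σ ≡ I₂ → σ ≈ₛ id
  ρ-mod-kernel σ ρσ≡I = λ { 0F → σ0≡0 ; 1F → σ1≡1 ; 2F → σ2≡2 }
    where
    σ-injective : ∀ {i j} → σ ⟨$⟩ʳ i ≡ σ ⟨$⟩ʳ j → i ≡ j
    σ-injective = Injection.injective (↔⇒↣ σ)
    σ2≢0 : σ ⟨$⟩ʳ 2F ≢ 0F
    σ2≢0 σ2≡0 =
      contradiction (σ-injective (trans (reduce-coord≡0ₙ⇒≡ σ2≡0 (cong b ρσ≡I)) (sym σ2≡0))) λ ()
    σ2≢1 : σ ⟨$⟩ʳ 2F ≢ 1F
    σ2≢1 σ2≡1 =
      contradiction (σ-injective (trans (reduce-coord≡0ₙ⇒≡ σ2≡1 (cong c ρσ≡I)) (sym σ2≡1))) λ ()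
    σ0≡0 : σ ⟨$⟩ʳ 0F ≡ 0F
    σ0≡0 = reduce-coord≡1ₙ⇒≡ σ2≢0 (cong a ρσ≡I)
    σ1≡1 : σ ⟨$⟩ʳ 1F ≡ 1F
    σ1≡1 = reduce-coord≡1ₙ⇒≡ σ2≢1 (cong d ρσ≡I)
    σ2≡2 : σ ⟨$⟩ʳ 2F ≡ 2F
    σ2≡2 = last-of-three σ2≢0 σ2≢1

  ρ-mod-injective : ∀ σ τ → ρ-mod σ ≡ ρ-mod τ → σ ≈ₛ τ
  ρ-mod-injective σ τ eq = ·ₛ-flip≈id⇒≈ σ τ (ρ-mod-kernel (σ ·ₛ flip τ) (begin
    ρ-mod (σ ·ₛ flip τ)       ≡⟨ ρ-mod-hom σ (flip τ) ⟨
    ρ-mod σ ⊗ ρ-mod (flip τ)  ≡⟨ cong (_⊗ ρ-mod (flip τ)) eq ⟩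
    ρ-mod τ ⊗ ρ-mod (flip τ)  ≡⟨ ρ-mod-hom τ (flip τ) ⟩
    ρ-mod (τ ·ₛ flip τ)       ≡⟨ ρ-mod-cong (τ ·ₛ flip τ) id (·ₛ-inverseʳ τ) ⟩
    ρ-mod id                  ∎))
    where open ≡-Reasoning

module _ {m n : ℕ} .{{_ : NonTrivial m}} .{{_ : NonTrivial n}} where

  private instance
    m≢0 : NonZero m
    m≢0 = nonTrivial⇒nonZero m
    n≢0 : NonZero n
    n≢0 = nonTrivial⇒nonZero n

  open ReducedRepresentation
  open Faithfulness using (ρ-mod-kernel; ρ-mod-injective)

  embed : S₃ → Elt {m} {n}
  embed σ = ρ-mod m σ , ρ-mod n σ

  Image : Elt {m} {n} → Set
  Image g = ∃ λ σ → embed σ ≡ g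

  embed-hom : ∀ σ τ → embed σ ·ᴱ embed τ ≡ embed (σ ·ₛ τ)
  embed-hom σ τ = cong₂ _,_ (ρ-mod-hom m σ τ) (ρ-mod-hom n σ τ)

  embed-cong : ∀ σ τ → σ ≈ₛ τ → embed σ ≡ embed τ
  embed-cong σ τ σ≈τ = cong₂ _,_ (ρ-mod-cong m σ τ σ≈τ) (ρ-mod-cong n σ τ σ≈τ)

  embed-injective : ∀ σ τ → embed σ ≡ embed τ → σ ≈ₛ τ
  embed-injective σ τ eq = ρ-mod-injective m σ τ (cong proj₁ eq)

  Image-isSubgroup : IsSubgroupOfGL₂×GL₂ Image
  Image-isSubgroup = record
    { ⊆GL₂×GL₂ = λ { _ (σ , refl) → ρ-mod-InGL₂ m σ , ρ-mod-InGL₂ n σ }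
    ; one∈     = id , refl
    ; mul∈     = λ { _ _ (σ , refl) (τ , refl) → σ ·ₛ τ , sym (embed-hom σ τ) }
    ; inv∈     = λ { _ (σ , refl) → embed (flip σ) , (flip σ , refl)
                   , trans (embed-hom σ (flip σ)) (embed-cong (σ ·ₛ flip σ) id (·ₛ-inverseʳ σ))
                   , trans (embed-hom (flip σ) σ) (embed-cong (flip σ ·ₛ σ) id (·ₛ-inverseˡ σ)) }
    }

  Image≅S₃ : IsoToS₃ Image
  Image≅S₃ = record
    { φ          = λ (_ , σ , _) → σ
    ; well-def   = λ { (_ , σ , refl) (_ , τ , refl) eq → embed-injective σ τ eq }
    ; hom        = λ { _ _ (σ , refl) (τ , refl) (υ , eq) →
                       embed-injective υ (σ ·ₛ τ) (trans eq (embed-hom σ τ)) }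
    ; injective  = λ { (_ , σ , refl) (_ , τ , refl) σ≈τ → embed-cong σ τ σ≈τ }
    ; surjective = λ σ → (embed σ , σ , refl) , λ _ → refl
    }

  Image-meets-left-trivially : TrivialMeetLeft Image
  Image-meets-left-trivially _ (σ , refl) ρσ≡I = embed-cong σ id (ρ-mod-kernel n σ ρσ≡I)

  Image-meets-right-trivially : TrivialMeetRight Image
  Image-meets-right-trivially _ (σ , refl) ρσ≡I = embed-cong σ id (ρ-mod-kernel m σ ρσ≡I)

  S₃-embeds-diagonally :
    Σ (Elt {m} {n} → Set) λ H →
      IsSubgroupOfGL₂×GL₂ H × IsoToS₃ H × TrivialMeetLeft H × TrivialMeetRight H
  S₃-embeds-diagonally =
    Image , Image-isSubgroup , Image≅S₃ , Image-meets-left-trivially , Image-meets-right-trivially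

lemma5p2 : (q : ℕ) (pq : Prime q) → Σ (Elt {2} {q} {{_}} {{prime⇒nonZero pq}} → Set) (λ H → IsSubgroupOfGL₂×GL₂ {{_}} {{prime⇒nonZero pq}} H × IsoToS₃ {{_}} {{prime⇒nonZero pq}} H × TrivialMeetLeft {{_}} {{prime⇒nonZero pq}} H × TrivialMeetRight {{_}} {{prime⇒nonZero pq}} H)
lemma5p2 q pq = S₃-embeds-diagonally {2} {q} {{_}} {{prime⇒nonTrivial pq}}
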